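{- Let $m,n\ge1$ and $\nu=(NE^m)^n$. The number of $m$-Dyck paths of height $n$ having maximal in-degree in the $\nu$-Tamari poset equals the number of $m$-Dyck paths of height $n$ having maximal out-degree in the $\nu$-Tamari poset.
   Context: For $\nu=(NE^m)^n$ (a path from $(0,0)$ to $(mn,n)$ with unit north steps $N$ and east steps $E$), an $m$-Dyck path of height $n$ is a lattice path from $(0,0)$ to $(mn,n)$ with $N$ and $E$ steps lying weakly above $\nu$. For such $D$ and $i\in[n]$, $r_i^D$ is the point immediately before its $i$-th north step. For $p=(x,y)$ on $D$, $\mathrm{horiz}(p)=X(y)-x$ with $X(y)$ the largest $x$-coordinate of a point of $\nu$ at height $y$. The touch point $t_i^D$ is the first point of $D$ after $r_i^D$ with the same horizontal distance as $r_i^D$. If $r_i^D$ is preceded by an east step, write $D=dEtf$ ($dE$ = subpath from $(0,0)$ to $r_i^D$, $t$ = subpath from $r_i^D$ to $t_i^D$, $f$ = the rest) and set $D\uparrow_i=dtEf$. The $\nu$-Tamari order is the partial order whose cover relations are $D\lessdot D\uparrow_i$ whenever defined. The in-degree (resp. out-degree) of $D$ is the number of elements covered by (resp. covering) $D$; maximal means equal to the maximum over all $m$-Dyck paths of height $n$. -}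

module Defs where

open import Data.Bool using (Bool; true; false; _∧_; _∨_; if_then_else_)
open import Data.Nat using (ℕ; zero; suc; _+_; _*_; _∸_; _⊔_; _<ᵇ_; _≤ᵇ_; _≡ᵇ_)
open import Data.List using (List; []; _∷_; _++_; length; take; drop; filterᵇ; foldr; map; upTo)
open import Data.Bool.ListAction using (any; all)
open import Data.Maybe using (Maybe; just; nothing)
open import Data.Product using (_×_; _,_; proj₁; proj₂)

data Step : Set where
  N E : Step

Path : Set
Path = List Step

stepEq : Step → Step → Bool
stepEq N N = true
stepEq E E = true
stepEq _ _ = false

pathEq : Path → Path → Bool
pathEq [] [] = true
pathEq (a ∷ p) (b ∷ q) = stepEq a b ∧ pathEq p q
pathEq _ _ = false

elemᵇ : Path → List Path → Bool
elemᵇ p = any (pathEq p)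

words : ℕ → ℕ → List Path
words zero zero = [] ∷ []
words zero (suc b) = map (E ∷_) (words zero b)
words (suc a) zero = map (N ∷_) (words a zero)
words (suc a) (suc b) = map (N ∷_) (words a (suc b)) ++ map (E ∷_) (words (suc a) b)

countE countN : Path → ℕ
countE [] = 0
countE (E ∷ p) = suc (countE p)
countE (N ∷ p) = countE p
countN [] = 0
countN (N ∷ p) = suc (countN p)
countN (E ∷ p) = countN p

pointAt : Path → ℕ → ℕ × ℕ
pointAt D k = countE (take k D) , countN (take k D)

-- ν = (N E^m)^n.  X(y) = largest x-coordinate of a point of ν at height y
-- (ν passes through (m(y-1),y),…,(my,y) for y ≥ 1 and only (0,0) at y = 0,
-- so X(y) = m·y for 0 ≤ y ≤ n).  The parameter n is kept for uniformity.
Xν : ℕ → ℕ → ℕ → ℕ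
Xν m n y = m * y

aboveν : ℕ → ℕ → Path → Bool
aboveν m n D = all (λ k → proj₁ (pointAt D k) ≤ᵇ Xν m n (proj₂ (pointAt D k)))
                   (upTo (suc (length D)))

dyckPaths : ℕ → ℕ → List Path
dyckPaths m n = filterᵇ (aboveν m n) (words n (m * n))

-- horiz(p) = X(y) - x  (nonnegative on Dyck paths).
horiz : ℕ → ℕ → ℕ × ℕ → ℕ
horiz m n (x , y) = Xν m n y ∸ x

firstWith : ℕ → ℕ → Path → ℕ → List ℕ → Maybe ℕ
firstWith m n D h [] = nothing
firstWith m n D h (j ∷ js) =
  if horiz m n (pointAt D j) ≡ᵇ h then just j else firstWith m n D h js

stepAt : Path → ℕ → Maybe Step
stepAt [] k = nothing
stepAt (s ∷ p) zero = just s
stepAt (s ∷ p) (suc k) = stepAt p k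

-- Given k, the index of a north step of D (so r = p_k is the point right
-- before that north step), if r is preceded by an east step, return D↑ = d t E f
-- where D = d E t f, dE = D up to r, t = D from r to the touch point t = p_j
-- (j = first index > k with horiz(p_j) = horiz(p_k)), f = the rest.
upAt : ℕ → ℕ → Path → ℕ → Maybe Path
upAt m n D zero = nothing
upAt m n D (suc k') with stepAt D (suc k') | stepAt D k'
... | just N | just E with firstWith m n D (horiz m n (pointAt D (suc k')))
                              (map (λ i → i + suc (suc k')) (upTo (length D ∸ suc k')))
...   | just j = just (take k' D ++ take (j ∸ suc k') (drop (suc k') D) ++ E ∷ drop j D)
...   | nothing = nothing
upAt m n D (suc k') | _ | _ = nothing

collect : List (Maybe Path) → List Path
collect [] = []
collect (just p ∷ ps) = p ∷ collect ps
collect (nothing ∷ ps) = collect ps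

ups : ℕ → ℕ → Path → List Path
ups m n D = collect (map (upAt m n D) (upTo (length D)))

-- Cover relation of the ν-Tamari order: D ⋖ D' iff D' = D↑_i for some i.
coversᵇ : ℕ → ℕ → Path → Path → Bool
coversᵇ m n D D' = elemᵇ D' (ups m n D)

count : {A : Set} → (A → Bool) → List A → ℕ
count p xs = length (filterᵇ p xs)

inDegree : ℕ → ℕ → Path → ℕ
inDegree m n D = count (λ D' → coversᵇ m n D' D) (dyckPaths m n)

outDegree : ℕ → ℕ → Path → ℕ
outDegree m n D = count (λ D' → coversᵇ m n D D') (dyckPaths m n)

maxOver : ℕ → ℕ → (Path → ℕ) → ℕ
maxOver m n f = foldr (λ D acc → f D ⊔ acc) 0 (dyckPaths m n)

numMaxIn : ℕ → ℕ → ℕ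
numMaxIn m n = count (λ D → inDegree m n D ≡ᵇ maxOver m n (inDegree m n)) (dyckPaths m n)

numMaxOut : ℕ → ℕ → ℕ
numMaxOut m n = count (λ D → outDegree m n D ≡ᵇ maxOver m n (outDegree m n)) (dyckPaths m n)

{-# OPTIONS --safe #-}
-- A cover D ⋖ D↑ᵢ is a rotation a E N p r ↦ a N p E r, where N p is the subpath from rᵢ to the
-- touch point, i.e. p is the shortest subpath lowering the horizontal distance by m. So the
-- out-degree of D counts the valleys E N admitting such a p, and the in-degree counts the north
-- steps whose p is followed by an east step. Under the bijection with (m+1)-ary trees (a node is
-- N followed by its m+1 subtrees separated by E steps) both become sums over nodes: the
-- out-degree counts internal children other than the first child, the in-degree internal
-- children other than the last. Reversing the children at every node is a size-preserving
-- involution exchanging the two statistics, so the multisets of in-degrees and of out-degrees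
-- over all m-Dyck paths of height n coincide, and so do the numbers of paths attaining the maximum.

module Submission where

open import Defs
open import Data.Bool using (Bool; true; false; if_then_else_; T)
open import Data.Bool.ListAction using (all; and)
open import Data.Bool.Properties using (T-≡)
open import Data.Empty using (⊥-elim)
open import Data.List using (List; []; _∷_; _++_; [_]; length; take; drop; map; upTo; applyUpTo; filterᵇ; foldr)
open import Data.List.Membership.Propositional using (_∈_; _∉_)
open import Data.List.Membership.Propositional.Properties
  using (∈-++⁺ˡ; ∈-++⁺ʳ; ∈-++⁻; ∈-map⁺; ∈-map⁻; ∈-filter⁺; ∈-filter⁻)
open import Data.List.Membership.Propositional.Properties.WithK using (unique∧set⇒bag)
open import Data.List.Properties
  using (++-assoc; ++-identityʳ; length-++; length-map; map-∘; map-cong; map-cong-local; map-upTo; map-applyUpTo;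
         foldr-map; ∷-injectiveʳ; ∷ʳ-injectiveˡ)
open import Data.List.Relation.Binary.BagAndSetEquality using (∼bag⇒↭)
open import Data.List.Relation.Binary.Permutation.Propositional using (_↭_; ↭-sym; ↭⇒↭ₛ)
import Data.List.Relation.Binary.Permutation.Propositional.Properties as ↭
import Data.List.Relation.Binary.Permutation.Setoid.Properties as ↭ₛ
import Data.List.Relation.Unary.All as All
import Data.List.Relation.Unary.AllPairs as AllPairs
open import Data.List.Relation.Unary.Any using (here; there)
open import Data.List.Relation.Unary.Unique.Propositional using (Unique)
import Data.List.Relation.Unary.Unique.Propositional.Properties as Unique
open import Data.Maybe using (Maybe; just; nothing)
import Data.Maybe as Maybe
open import Data.Maybe.Properties using (just-injective)
open import Data.Nat using (ℕ; zero; suc; _+_; _*_; _∸_; _≥_; _≤_; _<_; z≤n; s≤s; _≡ᵇ_; _≤ᵇ_; _⊔_)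
open import Data.Nat.Properties
open import Data.Nat.Solver using (module +-*-Solver)
open import Data.Product using (∃; ∃₂; _×_; _,_; proj₁; proj₂; map₁; map₂)
open import Data.Product.Properties using (,-injective)
open import Data.Sum using (inj₁; inj₂)
open import Data.Unit using (tt)
open import Data.Vec using (Vec; []; _∷_)
import Data.Vec as Vec
import Data.Vec.Properties as Vec
open import Function using (_∘_; Equivalence; _⇔_; mk⇔)
import Function.Properties.Equivalence as ⇔
open import Relation.Binary.PropositionalEquality hiding ([_])
open import Relation.Nullary using (¬_)
open import Relation.Nullary.Decidable using (T?)

open +-*-Solver using (solve; _:+_; _:=_)
open import Algebra.Properties.CommutativeSemigroup +-commutativeSemigroup using (xy∙z≈xz∙y; x∙yz≈y∙xz; interchange)

private variable
  a b c h k ℓ H H′ : ℕ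
  z : Step
  x y p r s D P Q : Path

countN-++ : ∀ x y → countN (x ++ y) ≡ countN x + countN y
countN-++ [] y = refl
countN-++ (N ∷ x) y = cong suc (countN-++ x y)
countN-++ (E ∷ x) y = countN-++ x y

take-length-++ : ∀ {A : Set} (x y : List A) → take (length x) (x ++ y) ≡ x
take-length-++ [] y = refl
take-length-++ (v ∷ x) y = cong (v ∷_) (take-length-++ x y)

drop-length-++ : ∀ {A : Set} (x y : List A) → drop (length x) (x ++ y) ≡ y
drop-length-++ [] y = refl
drop-length-++ (_ ∷ x) y = drop-length-++ x y

length-++E : ∀ (x y : Path) → length x < length (x ++ E ∷ y) × length y < length (x ++ E ∷ y)
length-++E [] y = s≤s z≤n , n<1+n (length y)
length-++E (_ ∷ x) y with length-++E x y
... | x< , y< = s≤s x< , m≤n⇒m≤1+n y<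

sum-∷ʳ : ∀ (xs : Vec ℕ k) x → Vec.sum (xs Vec.∷ʳ x) ≡ Vec.sum xs + x
sum-∷ʳ [] x = +-identityʳ x
sum-∷ʳ (y ∷ ys) x = trans (cong (y +_) (sum-∷ʳ ys x)) (sym (+-assoc y _ x))

sum-reverse : ∀ (xs : Vec ℕ k) → Vec.sum (Vec.reverse xs) ≡ Vec.sum xs
sum-reverse [] = refl
sum-reverse (x ∷ xs) = begin
  Vec.sum (Vec.reverse (x ∷ xs))    ≡⟨ cong Vec.sum (Vec.reverse-∷ x xs) ⟩
  Vec.sum (Vec.reverse xs Vec.∷ʳ x) ≡⟨ sum-∷ʳ (Vec.reverse xs) x ⟩
  Vec.sum (Vec.reverse xs) + x      ≡⟨ cong (_+ x) (sum-reverse xs) ⟩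
  Vec.sum xs + x                    ≡⟨ +-comm (Vec.sum xs) x ⟩
  Vec.sum (x ∷ xs)                  ∎
  where open ≡-Reasoning

≡ᵇ-refl : ∀ a → (a ≡ᵇ a) ≡ true
≡ᵇ-refl a = Equivalence.to T-≡ (≡⇒≡ᵇ a a refl)

≡ᵇ-false : a ≢ b → (a ≡ᵇ b) ≡ false
≡ᵇ-false {a} {b} a≢b with a ≡ᵇ b in eq
... | true = ⊥-elim (a≢b (≡ᵇ⇒≡ a b (Equivalence.from T-≡ eq)))
... | false = refl

collect-map : ∀ (g : Path → Path) qs → collect (map (Maybe.map g) qs) ≡ map g (collect qs)
collect-map g [] = refl
collect-map g (nothing ∷ qs) = collect-map g qs
collect-map g (just p ∷ qs) = cong (g p ∷_) (collect-map g qs)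

collect-∷ : ∀ q qs → collect (q ∷ qs) ≡ collect [ q ] ++ collect qs
collect-∷ nothing qs = refl
collect-∷ (just p) qs = refl

all-map : ∀ {A B : Set} (q : B → Bool) (f : A → B) xs → all q (map f xs) ≡ all (q ∘ f) xs
all-map q f xs = cong and (sym (map-∘ xs))

all-cong : ∀ {A : Set} {q q′ : A → Bool} → (∀ v → q v ≡ q′ v) → ∀ xs → all q xs ≡ all q′ xs
all-cong eq xs = cong and (map-cong eq xs)

≤ᵇ-suc : ∀ a b → (suc a ≤ᵇ suc b) ≡ (a ≤ᵇ b)
≤ᵇ-suc zero b = refl
≤ᵇ-suc (suc a) b = refl

∈-words⁺ : ∀ a b D → countN D ≡ a → countE D ≡ b → D ∈ words a b
∈-words⁺ zero zero [] refl refl = here refl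
∈-words⁺ zero zero (N ∷ D) () _
∈-words⁺ zero zero (E ∷ D) _ ()
∈-words⁺ (suc a) zero (N ∷ D) refl e = ∈-map⁺ (N ∷_) (∈-words⁺ a zero D refl e)
∈-words⁺ zero (suc b) (E ∷ D) e refl = ∈-map⁺ (E ∷_) (∈-words⁺ zero b D e refl)
∈-words⁺ (suc a) (suc b) (N ∷ D) refl e = ∈-++⁺ˡ (∈-map⁺ (N ∷_) (∈-words⁺ a (suc b) D refl e))
∈-words⁺ (suc a) (suc b) (E ∷ D) e refl = ∈-++⁺ʳ (map (N ∷_) (words a (suc b))) (∈-map⁺ (E ∷_) (∈-words⁺ (suc a) b D e refl))

∈-words⁻ : ∀ a b → D ∈ words a b → countN D ≡ a × countE D ≡ b
∈-words⁻ zero zero (here refl) = refl , refl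
∈-words⁻ zero (suc b) D∈ with ∈-map⁻ (E ∷_) D∈
... | _ , D′∈ , refl = map₂ (cong suc) (∈-words⁻ zero b D′∈)
∈-words⁻ (suc a) zero D∈ with ∈-map⁻ (N ∷_) D∈
... | _ , D′∈ , refl = map₁ (cong suc) (∈-words⁻ a zero D′∈)
∈-words⁻ (suc a) (suc b) D∈ with ∈-++⁻ (map (N ∷_) (words a (suc b))) D∈
... | inj₁ D∈N with ∈-map⁻ (N ∷_) D∈N
...   | _ , D′∈ , refl = map₁ (cong suc) (∈-words⁻ a (suc b) D′∈)
∈-words⁻ (suc a) (suc b) D∈ | inj₂ D∈E with ∈-map⁻ (E ∷_) D∈E
...   | _ , D′∈ , refl = map₂ (cong suc) (∈-words⁻ (suc a) b D′∈)

words-unique : ∀ a b → Unique (words a b)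
words-unique zero zero = All.[] AllPairs.∷ AllPairs.[]
words-unique zero (suc b) = Unique.map⁺ ∷-injectiveʳ (words-unique zero b)
words-unique (suc a) zero = Unique.map⁺ ∷-injectiveʳ (words-unique a zero)
words-unique (suc a) (suc b) =
  Unique.++⁺ (Unique.map⁺ ∷-injectiveʳ (words-unique a (suc b))) (Unique.map⁺ ∷-injectiveʳ (words-unique (suc a) b)) disjoint
  where
  disjoint : ∀ {D} → ¬ (D ∈ map (N ∷_) (words a (suc b)) × D ∈ map (E ∷_) (words (suc a) b))
  disjoint (D∈N , D∈E) with ∈-map⁻ (N ∷_) D∈N | ∈-map⁻ (E ∷_) D∈E
  ... | _ , _ , refl | _ , _ , ()

pathEq⇒≡ : ∀ p q → pathEq p q ≡ true → p ≡ q
pathEq⇒≡ [] [] _ = refl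
pathEq⇒≡ (N ∷ p) (N ∷ q) eq = cong (N ∷_) (pathEq⇒≡ p q eq)
pathEq⇒≡ (E ∷ p) (E ∷ q) eq = cong (E ∷_) (pathEq⇒≡ p q eq)
pathEq⇒≡ [] (_ ∷ _) ()
pathEq⇒≡ (_ ∷ _) [] ()
pathEq⇒≡ (N ∷ p) (E ∷ q) ()
pathEq⇒≡ (E ∷ p) (N ∷ q) ()

pathEq-refl : ∀ p → pathEq p p ≡ true
pathEq-refl [] = refl
pathEq-refl (N ∷ p) = pathEq-refl p
pathEq-refl (E ∷ p) = pathEq-refl p

elemᵇ⇔∈ : ∀ {v} xs → T (elemᵇ v xs) ⇔ v ∈ xs
elemᵇ⇔∈ {v} xs = mk⇔ (to xs) (from xs)
  where
  to : ∀ xs → T (elemᵇ v xs) → v ∈ xs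
  to (x ∷ xs) t with pathEq v x in eq
  ... | true = here (pathEq⇒≡ v x eq)
  ... | false = there (to xs t)
  from : ∀ xs → v ∈ xs → T (elemᵇ v xs)
  from (x ∷ xs) (here refl) rewrite pathEq-refl v = tt
  from (x ∷ xs) (there v∈) with pathEq v x
  ... | true = tt
  ... | false = from xs v∈

count≡length : ∀ {A : Set} (q : A → Bool) {xs ys : List A} → Unique xs → Unique ys →
               (∀ {v} → v ∈ xs → T (q v) ⇔ v ∈ ys) → (∀ {v} → v ∈ ys → v ∈ xs) → count q xs ≡ length ys
count≡length q {xs} {ys} uxs uys q⇔∈ ys⊆xs =
  ↭.↭-length (∼bag⇒↭ (unique∧set⇒bag (Unique.filter⁺ (T? ∘ q) uxs) uys (mk⇔ to from)))
  where
  to : ∀ {v} → v ∈ filterᵇ q xs → v ∈ ys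
  to v∈ with v∈xs , qv ← ∈-filter⁻ (T? ∘ q) v∈ = Equivalence.to (q⇔∈ v∈xs) qv
  from : ∀ {v} → v ∈ ys → v ∈ filterᵇ q xs
  from v∈ = ∈-filter⁺ (T? ∘ q) (ys⊆xs v∈) (Equivalence.from (q⇔∈ (ys⊆xs v∈)) v∈)

numMaximal : List ℕ → ℕ
numMaximal xs = count (_≡ᵇ foldr _⊔_ 0 xs) xs

count-map : ∀ {A B : Set} (q : B → Bool) (f : A → B) xs → count q (map f xs) ≡ count (q ∘ f) xs
count-map q f [] = refl
count-map q f (x ∷ xs) with q (f x)
... | true = cong suc (count-map q f xs)
... | false = count-map q f xs

count-maximal : ∀ {A : Set} (f : A → ℕ) xs → count (λ x → f x ≡ᵇ foldr (λ y acc → f y ⊔ acc) 0 xs) xs ≡ numMaximal (map f xs)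
count-maximal f xs rewrite sym (foldr-map _⊔_ f 0 xs) = sym (count-map _ f xs)

numMaximal-↭ : ∀ {xs ys} → xs ↭ ys → numMaximal xs ≡ numMaximal ys
numMaximal-↭ {xs} {ys} xs↭ys rewrite ↭ₛ.foldr-commMonoid (setoid ℕ) ⊔-0-isCommutativeMonoid (↭⇒↭ₛ xs↭ys) =
  ↭.↭-length (↭.filter-↭ (T? ∘ (_≡ᵇ foldr _⊔_ 0 ys)) xs↭ys)

everywhere : (Path → List Path) → Path → List Path
everywhere move [] = []
everywhere move (z ∷ D) = move (z ∷ D) ++ map (z ∷_) (everywhere move D)

length-everywhere : ∀ move z D → length (everywhere move (z ∷ D)) ≡ length (move (z ∷ D)) + length (everywhere move D)
length-everywhere move z D = trans (length-++ (move (z ∷ D))) (cong (length (move (z ∷ D)) +_) (length-map (z ∷_) (everywhere move D)))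

module _ {move : Path → List Path} where

  ∈-everywhere⁻ : P ∈ everywhere move D → ∃₂ λ a s → ∃ λ Q → D ≡ a ++ s × P ≡ a ++ Q × Q ∈ move s
  ∈-everywhere⁻ {D = z ∷ D} P∈ with ∈-++⁻ (move (z ∷ D)) P∈
  ... | inj₁ P∈move = [] , z ∷ D , _ , refl , refl , P∈move
  ... | inj₂ P∈rest with ∈-map⁻ (z ∷_) P∈rest
  ... | _ , P′∈ , refl with ∈-everywhere⁻ {D = D} P′∈
  ... | a , s , Q , refl , refl , Q∈ = z ∷ a , s , Q , refl , refl , Q∈

  ∈-everywhere⁺ : ∀ a → Q ∈ move (z ∷ s) → a ++ Q ∈ everywhere move (a ++ z ∷ s)
  ∈-everywhere⁺ [] Q∈ = ∈-++⁺ˡ Q∈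
  ∈-everywhere⁺ (y ∷ a) Q∈ = ∈-++⁺ʳ (move (y ∷ a ++ _)) (∈-map⁺ (y ∷_) (∈-everywhere⁺ a Q∈))

  everywhere-unique : (∀ D → length (move D) ≤ 1) → (∀ {z D Q} → z ∷ Q ∉ move (z ∷ D)) →
                      ∀ D → Unique (everywhere move D)
  everywhere-unique single fresh [] = AllPairs.[]
  everywhere-unique single fresh (z ∷ D) =
    Unique.++⁺ (atMostOne (single (z ∷ D))) (Unique.map⁺ ∷-injectiveʳ (everywhere-unique single fresh D)) disjoint
    where
    atMostOne : ∀ {xs : List Path} → length xs ≤ 1 → Unique xs
    atMostOne {[]} _ = AllPairs.[]
    atMostOne {_ ∷ []} _ = All.[] AllPairs.∷ AllPairs.[]
    atMostOne {_ ∷ _ ∷ _} (s≤s ())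
    disjoint : ∀ {P} → ¬ (P ∈ move (z ∷ D) × P ∈ map (z ∷_) (everywhere move D))
    disjoint (P∈ , P∈rest) with ∈-map⁻ (z ∷_) P∈rest
    ... | _ , _ , refl = fresh P∈

module Dyck (m : ℕ) where

  -- Walks and first drops

  -- Walk a D b: D, started at horizontal distance a from ν, stays weakly above ν and ends at distance b.
  data Walk : ℕ → Path → ℕ → Set where
    w[] : Walk a [] a
    wN  : Walk (a + m) x b → Walk a (N ∷ x) b
    wE  : Walk a x b → Walk (suc a) (E ∷ x) b

  walk-++ : Walk a x b → Walk b y c → Walk a (x ++ y) c
  walk-++ w[] v = v
  walk-++ (wN w) v = wN (walk-++ w v)
  walk-++ (wE w) v = wE (walk-++ w v)

  walk-++⁻ : ∀ x → Walk a (x ++ y) c → ∃ λ b → Walk a x b × Walk b y c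
  walk-++⁻ [] w = _ , w[] , w
  walk-++⁻ (N ∷ x) (wN w) with walk-++⁻ x w
  ... | b , u , v = b , wN u , v
  walk-++⁻ (E ∷ x) (wE w) with walk-++⁻ x w
  ... | b , u , v = b , wE u , v

  walk-functional : Walk a x b → Walk a x c → b ≡ c
  walk-functional w[] w[] = refl
  walk-functional (wN u) (wN v) = walk-functional u v
  walk-functional (wE u) (wE v) = walk-functional u v

  walk-suc : Walk a x b → Walk (suc a) x (suc b)
  walk-suc w[] = w[]
  walk-suc (wN w) = wN (walk-suc w)
  walk-suc (wE w) = wE (walk-suc w)

  walk-countN : Walk a x b → a + m * countN x ≡ b + countE x
  walk-countN {a} w[] = cong (a +_) (*-zeroʳ m)
  walk-countN {a} {N ∷ x} {b} (wN w) = begin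
    a + m * suc (countN x)  ≡⟨ cong (a +_) (*-suc m (countN x)) ⟩
    a + (m + m * countN x)  ≡⟨ +-assoc a m _ ⟨
    a + m + m * countN x    ≡⟨ walk-countN w ⟩
    b + countE x            ∎
    where open ≡-Reasoning
  walk-countN {suc a} {E ∷ x} {b} (wE w) = trans (cong suc (walk-countN w)) (sym (+-suc b (countE x)))

  -- FirstDrop ℓ p: p lowers the horizontal distance by ℓ, reaching the lower level only at its end.
  data FirstDrop : ℕ → Path → Set where
    fd[] : FirstDrop 0 []
    fdE  : FirstDrop ℓ p → FirstDrop (suc ℓ) (E ∷ p)
    fdN  : FirstDrop (suc ℓ + m) p → FirstDrop (suc ℓ) (N ∷ p)

  firstDrop-walk : FirstDrop ℓ p → ∀ h → Walk (ℓ + h) p h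
  firstDrop-walk fd[] h = w[]
  firstDrop-walk (fdE d) h = wE (firstDrop-walk d h)
  firstDrop-walk (fdN {ℓ} {p} d) h = wN (subst (λ k → Walk k p h) (xy∙z≈xz∙y (suc ℓ) m h) (firstDrop-walk d h))

  walk-firstDrop : ∀ ℓ → Walk (ℓ + h) s b → b ≤ h → ∃₂ λ p r → FirstDrop ℓ p × s ≡ p ++ r
  walk-firstDrop zero w _ = [] , _ , fd[] , refl
  walk-firstDrop {h} (suc ℓ) w[] b≤h = ⊥-elim (n≮n h (≤-trans (s≤s (m≤n+m h ℓ)) b≤h))
  walk-firstDrop (suc ℓ) (wE w) b≤h with walk-firstDrop ℓ w b≤h
  ... | p , r , d , refl = E ∷ p , r , fdE d , refl
  walk-firstDrop {h} {N ∷ s} {b} (suc ℓ) (wN w) b≤h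
    with walk-firstDrop (suc ℓ + m) (subst (λ k → Walk k s b) (xy∙z≈xz∙y (suc ℓ) h m) w) b≤h
  ... | p , r , d , refl = N ∷ p , r , fdN d , refl

  walk-firstDrop-m : Walk (a + m) x b → b ≤ a → ∃₂ λ p r → FirstDrop m p × x ≡ p ++ r
  walk-firstDrop-m {a} {x} {b} w = walk-firstDrop m (subst (λ c → Walk c x b) (+-comm a m) w)

  walk-firstDrop-++ : Walk a x b → FirstDrop (suc b + c) p → FirstDrop (suc a + c) (x ++ p)
  walk-firstDrop-++ w[] d = d
  walk-firstDrop-++ {a} {N ∷ x} {c = c} {p} (wN w) d =
    fdN (subst (λ ℓ → FirstDrop ℓ (x ++ p)) (xy∙z≈xz∙y (suc a) m c) (walk-firstDrop-++ w d))
  walk-firstDrop-++ (wE w) d = fdE (walk-firstDrop-++ w d)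

  walk-descent : ∀ d → Walk (d + suc h) s 0 → ∃₂ λ x s′ → s ≡ x ++ E ∷ s′ × Walk d x 0 × Walk h s′ 0
  walk-descent zero (wE w) = [] , _ , refl , w[] , w
  walk-descent {h} zero (wN {x = s} w) with walk-descent m (subst (λ c → Walk c s 0) (+-comm (suc h) m) w)
  ... | x , s′ , refl , wx , ws = N ∷ x , s′ , refl , wN wx , ws
  walk-descent (suc d) (wE w) with walk-descent d w
  ... | x , s′ , refl , wx , ws = E ∷ x , s′ , refl , wE wx , ws
  walk-descent {h} (suc d) (wN {x = s} w)
    with walk-descent (suc d + m) (subst (λ c → Walk c s 0) (xy∙z≈xz∙y (suc d) (suc h) m) w)
  ... | x , s′ , refl , wx , ws = N ∷ x , s′ , refl , wN wx , ws

  splitAtDrop : ℕ → Path → Maybe (Path × Path)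
  splitAtDrop zero s = just ([] , s)
  splitAtDrop (suc ℓ) [] = nothing
  splitAtDrop (suc ℓ) (E ∷ s) = Maybe.map (map₁ (E ∷_)) (splitAtDrop ℓ s)
  splitAtDrop (suc ℓ) (N ∷ s) = Maybe.map (map₁ (N ∷_)) (splitAtDrop (suc ℓ + m) s)

  splitAtDrop-++ : FirstDrop ℓ p → ∀ r → splitAtDrop ℓ (p ++ r) ≡ just (p , r)
  splitAtDrop-++ fd[] r = refl
  splitAtDrop-++ (fdE d) r rewrite splitAtDrop-++ d r = refl
  splitAtDrop-++ (fdN d) r rewrite splitAtDrop-++ d r = refl

  splitAtDrop⁻ : ∀ ℓ s → splitAtDrop ℓ s ≡ just (p , r) → FirstDrop ℓ p × s ≡ p ++ r
  splitAtDrop⁻ zero s refl = fd[] , refl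
  splitAtDrop⁻ (suc ℓ) (E ∷ s) eq with splitAtDrop ℓ s in eq′
  splitAtDrop⁻ (suc ℓ) (E ∷ s) refl | just _ with splitAtDrop⁻ ℓ s eq′
  ... | d , refl = fdE d , refl
  splitAtDrop⁻ (suc ℓ) (N ∷ s) eq with splitAtDrop (suc ℓ + m) s in eq′
  splitAtDrop⁻ (suc ℓ) (N ∷ s) refl | just _ with splitAtDrop⁻ (suc ℓ + m) s eq′
  ... | d , refl = fdN d , refl

  firstDrop-++-injective : ∀ {p′ r r′} → FirstDrop ℓ p → FirstDrop ℓ p′ → p ++ r ≡ p′ ++ r′ → p ≡ p′ × r ≡ r′
  firstDrop-++-injective {ℓ} {r = r} {r′} d d′ eq =
    ,-injective (just-injective (trans (sym (splitAtDrop-++ d r)) (trans (cong (splitAtDrop ℓ) eq) (splitAtDrop-++ d′ r′))))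

  -- The first drop of 1 in x ++ E ∷ y is x ++ [ E ], since x returns to its starting level.
  walk-++E-injective : ∀ {x′ y y′} → Walk 0 x 0 → Walk 0 x′ 0 → x ++ E ∷ y ≡ x′ ++ E ∷ y′ → x ≡ x′ × y ≡ y′
  walk-++E-injective {x} {x′} {y} {y′} w w′ eq
    with firstDrop-++-injective (walk-firstDrop-++ w (fdE fd[])) (walk-firstDrop-++ w′ (fdE fd[]))
           (trans (++-assoc x [ E ] y) (trans eq (sym (++-assoc x′ [ E ] y′))))
  ... | x∷ʳE≡ , y≡ = ∷ʳ-injectiveˡ x x′ x∷ʳE≡ , y≡

  -- Covers as rotations

  -- Rotation D D′ is the cover D ⋖ D↑ᵢ: the east step before the i-th north step of D jumps
  -- over the subpath N p from rᵢ to the touch point tᵢ.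
  data Rotation : Path → Path → Set where
    rotate : ∀ a {p} r → FirstDrop m p → Rotation (a ++ E ∷ N ∷ p ++ r) (a ++ N ∷ p ++ E ∷ r)

  rotateUp : Maybe (Path × Path) → List Path
  rotateUp (just (p , r)) = [ N ∷ p ++ E ∷ r ]
  rotateUp nothing = []

  upMove : Path → List Path
  upMove (E ∷ N ∷ s) = rotateUp (splitAtDrop m s)
  upMove _ = []

  rotateDown : Maybe (Path × Path) → List Path
  rotateDown (just (p , E ∷ f)) = [ E ∷ N ∷ p ++ f ]
  rotateDown _ = []

  downMove : Path → List Path
  downMove (N ∷ s) = rotateDown (splitAtDrop m s)
  downMove _ = []

  upperCovers lowerCovers : Path → List Path
  upperCovers = everywhere upMove
  lowerCovers = everywhere downMove

  ∈-upperCovers⁻ : P ∈ upperCovers D → Rotation D P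
  ∈-upperCovers⁻ {D = D} P∈ with ∈-everywhere⁻ {D = D} P∈
  ... | a , E ∷ N ∷ s , _ , refl , refl , Q∈ with splitAtDrop m s in eq
  ∈-upperCovers⁻ P∈ | a , E ∷ N ∷ s , _ , refl , refl , here refl | just _ with splitAtDrop⁻ m s eq
  ... | d , refl = rotate a _ d

  ∈-upperCovers⁺ : Rotation D P → P ∈ upperCovers D
  ∈-upperCovers⁺ (rotate a r d) = ∈-everywhere⁺ a (subst (λ q → _ ∈ rotateUp q) (sym (splitAtDrop-++ d r)) (here refl))

  ∈-lowerCovers⁻ : Q ∈ lowerCovers D → Rotation Q D
  ∈-lowerCovers⁻ {D = D} Q∈ with ∈-everywhere⁻ {D = D} Q∈
  ... | a , N ∷ s , _ , refl , refl , Q∈ with splitAtDrop m s in eq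
  ∈-lowerCovers⁻ Q∈ | a , N ∷ s , _ , refl , refl , here refl | just (_ , E ∷ f) with splitAtDrop⁻ m s eq
  ... | d , refl = rotate a f d

  ∈-lowerCovers⁺ : Rotation Q D → Q ∈ lowerCovers D
  ∈-lowerCovers⁺ (rotate a r d) = ∈-everywhere⁺ a (subst (λ q → _ ∈ rotateDown q) (sym (splitAtDrop-++ d (E ∷ r))) (here refl))

  length-rotateUp : ∀ q → length (rotateUp q) ≤ 1
  length-rotateUp (just _) = s≤s z≤n
  length-rotateUp nothing = z≤n

  length-rotateDown : ∀ q → length (rotateDown q) ≤ 1
  length-rotateDown (just (_ , E ∷ _)) = s≤s z≤n
  length-rotateDown (just (_ , N ∷ _)) = z≤n
  length-rotateDown (just (_ , [])) = z≤n
  length-rotateDown nothing = z≤n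

  upperCovers-unique : ∀ D → Unique (upperCovers D)
  upperCovers-unique = everywhere-unique single fresh
    where
    single : ∀ D → length (upMove D) ≤ 1
    single (E ∷ N ∷ s) = length-rotateUp (splitAtDrop m s)
    single [] = z≤n
    single (N ∷ _) = z≤n
    single (E ∷ []) = z≤n
    single (E ∷ E ∷ _) = z≤n
    fresh : z ∷ Q ∉ upMove (z ∷ D)
    fresh {E} {D = N ∷ s} Q∈ with splitAtDrop m s
    fresh {E} {D = N ∷ s} (here ()) | just _
    fresh {E} {D = E ∷ _} ()
    fresh {E} {D = []} ()
    fresh {N} ()

  lowerCovers-unique : ∀ D → Unique (lowerCovers D)
  lowerCovers-unique = everywhere-unique single fresh
    where
    single : ∀ D → length (downMove D) ≤ 1
    single (N ∷ s) = length-rotateDown (splitAtDrop m s)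
    single [] = z≤n
    single (E ∷ _) = z≤n
    fresh : z ∷ Q ∉ downMove (z ∷ D)
    fresh {N} {D = s} Q∈ with splitAtDrop m s
    fresh {N} (here ()) | just (_ , E ∷ _)
    fresh {N} () | just (_ , N ∷ _)
    fresh {N} () | just (_ , [])
    fresh {N} () | nothing
    fresh {E} ()

  rotation-countN : Rotation D P → countN P ≡ countN D
  rotation-countN (rotate a {p} r _) = begin
    countN (a ++ N ∷ p ++ E ∷ r)          ≡⟨ countN-++ a _ ⟩
    countN a + suc (countN (p ++ E ∷ r))  ≡⟨ cong (λ k → countN a + suc k) (trans (countN-++ p (E ∷ r)) (sym (countN-++ p r))) ⟩
    countN a + suc (countN (p ++ r))      ≡⟨ countN-++ a _ ⟨
    countN (a ++ E ∷ N ∷ p ++ r)          ∎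
    where open ≡-Reasoning

  rotation-walk⁺ : Rotation D P → Walk a D b → Walk a P b
  rotation-walk⁺ (rotate x {p} r d) w with walk-++⁻ x w
  ... | suc h , wx , wE (wN wpr) with walk-++⁻ p wpr
  ... | _ , wp , wr with refl ← walk-functional wp (subst (λ k → Walk k p h) (+-comm m h) (firstDrop-walk d h))
    = walk-++ wx (wN (walk-++ (subst (λ k → Walk k p (suc h)) (cong suc (+-comm m h)) (walk-suc (firstDrop-walk d h))) (wE wr)))

  rotation-walk⁻ : Rotation D P → Walk a P b → Walk a D b
  rotation-walk⁻ (rotate x {p} r d) w with walk-++⁻ x w
  ... | h , wx , wN wper with walk-++⁻ p wper
  ... | _ , wp , wE {h′} wr with refl ← walk-functional wp (subst (λ k → Walk k p h) (+-comm m h) (firstDrop-walk d h))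
    = walk-++ wx (wE (wN (walk-++ (subst (λ k → Walk k p h′) (+-comm m h′) (firstDrop-walk d h′)) wr)))

  upMove-++E : Walk a (z ∷ x) 0 → ∀ y → length (upMove (z ∷ x ++ E ∷ y)) ≡ length (upMove (z ∷ x))
  upMove-++E {z = N} _ y = refl
  upMove-++E {z = E} {[]} _ y = refl
  upMove-++E {z = E} {E ∷ _} _ y = refl
  upMove-++E {z = E} {N ∷ x} (wE (wN w)) y with walk-firstDrop-m w z≤n
  ... | p , r , d , refl rewrite ++-assoc p r (E ∷ y) | splitAtDrop-++ d (r ++ E ∷ y) | splitAtDrop-++ d r = refl

  upperCovers-++E : Walk a x 0 → ∀ y → length (upperCovers (x ++ E ∷ y)) ≡ length (upperCovers x) + length (upperCovers (E ∷ y))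
  upperCovers-++E w[] y = refl
  upperCovers-++E {x = z ∷ x} w y = begin
    length (upperCovers (z ∷ x ++ E ∷ y))
      ≡⟨ length-everywhere upMove z (x ++ E ∷ y) ⟩
    length (upMove (z ∷ x ++ E ∷ y)) + length (upperCovers (x ++ E ∷ y))
      ≡⟨ cong₂ _+_ (upMove-++E w y) (upperCovers-++E (proj₂ (tail-walk w)) y) ⟩
    length (upMove (z ∷ x)) + (length (upperCovers x) + length (upperCovers (E ∷ y)))
      ≡⟨ +-assoc (length (upMove (z ∷ x))) _ _ ⟨
    length (upMove (z ∷ x)) + length (upperCovers x) + length (upperCovers (E ∷ y))
      ≡⟨ cong (_+ length (upperCovers (E ∷ y))) (length-everywhere upMove z x) ⟨
    length (upperCovers (z ∷ x)) + length (upperCovers (E ∷ y)) ∎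
    where
    open ≡-Reasoning
    tail-walk : Walk a (z ∷ x) 0 → ∃ λ a′ → Walk a′ x 0
    tail-walk (wN w) = _ , w
    tail-walk (wE w) = _ , w

  endsHere restNonEmpty : Maybe (Path × Path) → ℕ
  endsHere (just (_ , [])) = 1
  endsHere _ = 0
  restNonEmpty (just (_ , _ ∷ _)) = 1
  restNonEmpty _ = 0

  -- The number of north steps of x whose first drop ends exactly at the end of x.
  closingDrops : Path → ℕ
  closingDrops [] = 0
  closingDrops (E ∷ x) = closingDrops x
  closingDrops (N ∷ x) = endsHere (splitAtDrop m x) + closingDrops x

  downMove-++E : Walk a (N ∷ x) 0 → ∀ y → length (downMove (N ∷ x ++ E ∷ y)) ≡ length (downMove (N ∷ x)) + endsHere (splitAtDrop m x)
  downMove-++E (wN w) y with walk-firstDrop-m w z≤n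
  ... | p , r , d , refl rewrite ++-assoc p r (E ∷ y) | splitAtDrop-++ d (r ++ E ∷ y) | splitAtDrop-++ d r = extend r
    where
    extend : ∀ r → length (rotateDown (just (p , r ++ E ∷ y))) ≡ length (rotateDown (just (p , r))) + endsHere (just (p , r))
    extend [] = refl
    extend (E ∷ _) = refl
    extend (N ∷ _) = refl

  lowerCovers-++E : Walk a x 0 → ∀ y → length (lowerCovers (x ++ E ∷ y)) ≡ length (lowerCovers x) + closingDrops x + length (lowerCovers y)
  lowerCovers-++E w[] y = length-everywhere downMove E y
  lowerCovers-++E (wE {x = x} w) y = begin
    length (lowerCovers (E ∷ x ++ E ∷ y))                         ≡⟨ length-everywhere downMove E (x ++ E ∷ y) ⟩
    length (lowerCovers (x ++ E ∷ y))                             ≡⟨ lowerCovers-++E w y ⟩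
    length (lowerCovers x) + closingDrops x + length (lowerCovers y)
      ≡⟨ cong (λ l → l + closingDrops x + length (lowerCovers y)) (length-everywhere downMove E x) ⟨
    length (lowerCovers (E ∷ x)) + closingDrops x + length (lowerCovers y) ∎
    where open ≡-Reasoning
  lowerCovers-++E w@(wN {x = x} w′) y = begin
    length (lowerCovers (N ∷ x ++ E ∷ y))
      ≡⟨ length-everywhere downMove N (x ++ E ∷ y) ⟩
    length (downMove (N ∷ x ++ E ∷ y)) + length (lowerCovers (x ++ E ∷ y))
      ≡⟨ cong₂ _+_ (downMove-++E w y) (lowerCovers-++E w′ y) ⟩
    (atHead + ends) + (length (lowerCovers x) + closingDrops x + length (lowerCovers y))
      ≡⟨ rearrange atHead ends (length (lowerCovers x)) (closingDrops x) (length (lowerCovers y)) ⟩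
    (atHead + length (lowerCovers x)) + (ends + closingDrops x) + length (lowerCovers y)
      ≡⟨ cong (λ l → l + closingDrops (N ∷ x) + length (lowerCovers y)) (length-everywhere downMove N x) ⟨
    length (lowerCovers (N ∷ x)) + closingDrops (N ∷ x) + length (lowerCovers y) ∎
    where
    open ≡-Reasoning
    atHead = length (downMove (N ∷ x))
    ends = endsHere (splitAtDrop m x)
    rearrange : ∀ a b c d e → (a + b) + (c + d + e) ≡ (a + c) + (b + d) + e
    rearrange = solve 5 (λ a b c d e → (a :+ b) :+ (c :+ d :+ e) := (a :+ c) :+ (b :+ d) :+ e) refl

  restNonEmpty-∷ : ∀ q → restNonEmpty (Maybe.map (map₁ (z ∷_)) q) ≡ restNonEmpty q
  restNonEmpty-∷ (just (_ , [])) = refl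
  restNonEmpty-∷ (just (_ , _ ∷ _)) = refl
  restNonEmpty-∷ nothing = refl

  closingDrops-walk : Walk a x 0 → closingDrops x ≡ restNonEmpty (splitAtDrop a x)
  closingDrops-walk w[] = refl
  closingDrops-walk (wE {a} {x} w) = trans (closingDrops-walk w) (sym (restNonEmpty-∷ (splitAtDrop a x)))
  closingDrops-walk (wN {zero} w) with walk-firstDrop-m w z≤n
  ... | p , r , d , refl rewrite closingDrops-walk w | splitAtDrop-++ d r = ends+rest r
    where
    ends+rest : ∀ r → endsHere (just (p , r)) + restNonEmpty (just (p , r)) ≡ 1
    ends+rest [] = refl
    ends+rest (_ ∷ _) = refl
  closingDrops-walk (wN {suc a} {x} w) with walk-firstDrop-m w z≤n
  ... | p , r , d , refl with walk-++⁻ p w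
  ... | _ , wp , wr with refl ← walk-functional wp (subst (λ c → Walk c p (suc a)) (+-comm m (suc a)) (firstDrop-walk d (suc a)))
    rewrite splitAtDrop-++ d r =
      cong₂ _+_ (notEnding r wr) (trans (closingDrops-walk w) (sym (restNonEmpty-∷ (splitAtDrop (suc a + m) (p ++ r)))))
    where
    notEnding : ∀ r → Walk (suc a) r 0 → endsHere (just (p , r)) ≡ 0
    notEnding (_ ∷ _) _ = refl

  -- The index-based covers of the definition

  -- The horizontal distance at the j-th point of D when D starts at distance H;
  -- horizFrom 0 D j is horiz (pointAt D j).
  horizFrom : ℕ → Path → ℕ → ℕ
  horizFrom H D j = (H + m * countN (take j D)) ∸ countE (take j D)

  firstAt : ℕ → Path → ℕ → List ℕ → Maybe ℕ
  firstAt H D h [] = nothing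
  firstAt H D h (j ∷ js) = if horizFrom H D j ≡ᵇ h then just j else firstAt H D h js

  rotatedAt : Path → ℕ → ℕ → Path
  rotatedAt D k j = take k D ++ take (j ∸ suc k) (drop (suc k) D) ++ E ∷ drop j D

  upAtSteps : ℕ → Path → ℕ → Maybe Step → Maybe Step → Maybe Path
  upAtSteps H D k (just N) (just E) =
    Maybe.map (rotatedAt D k) (firstAt H D (horizFrom H D (suc k)) (map (λ i → i + suc (suc k)) (upTo (length D ∸ suc k))))
  upAtSteps H D k _ _ = nothing

  upAtFrom : ℕ → Path → ℕ → Maybe Path
  upAtFrom H D zero = nothing
  upAtFrom H D (suc k) = upAtSteps H D k (stepAt D (suc k)) (stepAt D k)

  upsFrom : ℕ → Path → List Path
  upsFrom H D = collect (map (upAtFrom H D) (upTo (length D)))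

  firstWith≡firstAt : ∀ n D h js → firstWith m n D h js ≡ firstAt 0 D h js
  firstWith≡firstAt n D h [] = refl
  firstWith≡firstAt n D h (j ∷ js) rewrite firstWith≡firstAt n D h js = refl

  upAt≡upAtFrom : ∀ n D k → upAt m n D k ≡ upAtFrom 0 D k
  upAt≡upAtFrom n D zero = refl
  upAt≡upAtFrom n D (suc k) with stepAt D (suc k) | stepAt D k
  ... | just N | just E
    with firstWith m n D (horizFrom 0 D (suc k)) (map (λ i → i + suc (suc k)) (upTo (length D ∸ suc k)))
       | firstWith≡firstAt n D (horizFrom 0 D (suc k)) (map (λ i → i + suc (suc k)) (upTo (length D ∸ suc k)))
  ... | just j | eq rewrite sym eq = refl
  ... | nothing | eq rewrite sym eq = refl
  upAt≡upAtFrom n D (suc k) | just N | just N = refl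
  upAt≡upAtFrom n D (suc k) | just N | nothing = refl
  upAt≡upAtFrom n D (suc k) | just E | _ = refl
  upAt≡upAtFrom n D (suc k) | nothing | _ = refl

  ups≡upsFrom : ∀ n D → ups m n D ≡ upsFrom 0 D
  ups≡upsFrom n D = cong collect (map-cong (upAt≡upAtFrom n D) (upTo (length D)))

  horizFrom-0 : ∀ H D → horizFrom H D 0 ≡ H
  horizFrom-0 H D = trans (cong (H +_) (*-zeroʳ m)) (+-identityʳ H)

  horizFrom-0≢ : ∀ ℓ h D → horizFrom (suc ℓ + h) D 0 ≢ h
  horizFrom-0≢ ℓ h D eq = m≢1+n+m h (trans (sym eq) (horizFrom-0 (suc ℓ + h) D))

  horizFrom-∷ : Walk H (z ∷ []) H′ → ∀ j → horizFrom H (z ∷ D) (suc j) ≡ horizFrom H′ D j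
  horizFrom-∷ (wE w[]) j = refl
  horizFrom-∷ {H} {D = D} (wN w[]) j = cong (_∸ countE (take j D)) (begin
    H + m * suc (countN (take j D))  ≡⟨ cong (H +_) (*-suc m _) ⟩
    H + (m + m * countN (take j D))  ≡⟨ +-assoc H m _ ⟨
    H + m + m * countN (take j D)    ∎)
    where open ≡-Reasoning

  firstAt-∷ : Walk H (z ∷ []) H′ → ∀ js → firstAt H (z ∷ D) h (map suc js) ≡ Maybe.map suc (firstAt H′ D h js)
  firstAt-∷ w [] = refl
  firstAt-∷ {H′ = H′} {D = D} {h = h} w (j ∷ js) rewrite horizFrom-∷ {D = D} w j with horizFrom H′ D j ≡ᵇ h
  ... | true = refl
  ... | false = firstAt-∷ w js

  dropLength : Maybe (Path × Path) → Maybe ℕ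
  dropLength = Maybe.map (length ∘ proj₁)

  dropLength-∷ : ∀ q → dropLength (Maybe.map (map₁ (z ∷_)) q) ≡ Maybe.map suc (dropLength q)
  dropLength-∷ (just _) = refl
  dropLength-∷ nothing = refl

  upTo-suc : ∀ L → upTo (suc L) ≡ 0 ∷ map suc (upTo L)
  upTo-suc L = cong (0 ∷_) (sym (map-upTo suc L))

  firstAt-hit : horizFrom H D 0 ≡ h → ∀ js → firstAt H D h (0 ∷ js) ≡ just 0
  firstAt-hit {h = h} eq js rewrite eq | ≡ᵇ-refl h = refl

  firstAt-skip : horizFrom H D 0 ≢ h → ∀ js → firstAt H D h (0 ∷ js) ≡ firstAt H D h js
  firstAt-skip ne js rewrite ≡ᵇ-false ne = refl

  -- The touch point is found by firstAt exactly where the first drop ends.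
  firstAt-firstDrop : ∀ ℓ s → H ≡ ℓ + h → firstAt H s h (upTo (suc (length s))) ≡ dropLength (splitAtDrop ℓ s)
  firstAt-firstDrop {h = h} zero s refl = firstAt-hit {D = s} (horizFrom-0 h s) (applyUpTo suc (length s))
  firstAt-firstDrop {h = h} (suc ℓ) [] refl = firstAt-skip {D = []} (horizFrom-0≢ ℓ h []) []
  firstAt-firstDrop {h = h} (suc ℓ) (z ∷ s) refl = begin
    firstAt (suc ℓ + h) (z ∷ s) h (upTo (suc (suc (length s))))
      ≡⟨ cong (firstAt (suc ℓ + h) (z ∷ s) h) (upTo-suc (suc (length s))) ⟩
    firstAt (suc ℓ + h) (z ∷ s) h (0 ∷ map suc (upTo (suc (length s))))
      ≡⟨ firstAt-skip {D = z ∷ s} (horizFrom-0≢ ℓ h (z ∷ s)) (map suc (upTo (suc (length s)))) ⟩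
    firstAt (suc ℓ + h) (z ∷ s) h (map suc (upTo (suc (length s))))
      ≡⟨ step z ⟩
    dropLength (splitAtDrop (suc ℓ) (z ∷ s)) ∎
    where
    open ≡-Reasoning
    step : ∀ z → firstAt (suc ℓ + h) (z ∷ s) h (map suc (upTo (suc (length s)))) ≡ dropLength (splitAtDrop (suc ℓ) (z ∷ s))
    step E = trans (firstAt-∷ {D = s} {h = h} (wE w[]) (upTo (suc (length s))))
               (trans (cong (Maybe.map suc) (firstAt-firstDrop ℓ s refl))
                      (sym (dropLength-∷ (splitAtDrop ℓ s))))
    step N = trans (firstAt-∷ {D = s} {h = h} (wN w[]) (upTo (suc (length s))))
               (trans (cong (Maybe.map suc) (firstAt-firstDrop (suc ℓ + m) s (xy∙z≈xz∙y (suc ℓ) h m)))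
                      (sym (dropLength-∷ (splitAtDrop (suc ℓ + m) s))))

  rotatedAt-∷ : ∀ k (q : Maybe ℕ) → Maybe.map (rotatedAt (z ∷ D) (suc k)) (Maybe.map suc q) ≡ Maybe.map (z ∷_) (Maybe.map (rotatedAt D k) q)
  rotatedAt-∷ k (just _) = refl
  rotatedAt-∷ k nothing = refl

  upAtFrom-∷ : Walk H (z ∷ []) H′ → ∀ k → upAtFrom H (z ∷ D) (suc (suc k)) ≡ Maybe.map (z ∷_) (upAtFrom H′ D (suc k))
  upAtFrom-∷ {H} {z} {H′} {D} w k with stepAt D (suc k) | stepAt D k
  ... | just N | just E = begin
    Maybe.map (rotatedAt (z ∷ D) (suc k))
      (firstAt H (z ∷ D) (horizFrom H (z ∷ D) (suc (suc k))) (map (λ i → i + suc (suc (suc k))) (upTo L)))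
      ≡⟨ cong₂ (λ h is → Maybe.map (rotatedAt (z ∷ D) (suc k)) (firstAt H (z ∷ D) h is)) (horizFrom-∷ w (suc k)) shifted ⟩
    Maybe.map (rotatedAt (z ∷ D) (suc k)) (firstAt H (z ∷ D) h′ (map suc js))
      ≡⟨ cong (Maybe.map (rotatedAt (z ∷ D) (suc k))) (firstAt-∷ {D = D} {h = h′} w js) ⟩
    Maybe.map (rotatedAt (z ∷ D) (suc k)) (Maybe.map suc (firstAt H′ D h′ js))
      ≡⟨ rotatedAt-∷ {z = z} {D = D} k (firstAt H′ D h′ js) ⟩
    Maybe.map (z ∷_) (Maybe.map (rotatedAt D k) (firstAt H′ D h′ js)) ∎
    where
    open ≡-Reasoning
    L = length D ∸ suc k
    js = map (λ i → i + suc (suc k)) (upTo L)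
    h′ = horizFrom H′ D (suc k)
    shifted : map (λ i → i + suc (suc (suc k))) (upTo L) ≡ map suc js
    shifted = trans (map-cong (λ i → +-suc i (suc (suc k))) (upTo L)) (map-∘ (upTo L))
  ... | just N | just N = refl
  ... | just N | nothing = refl
  ... | just E | _ = refl
  ... | nothing | _ = refl

  firstAt-touch : ∀ H′ D′ →
    firstAt (suc H′) (E ∷ N ∷ D′) (horizFrom (suc H′) (E ∷ N ∷ D′) 1) (map (λ i → i + 2) (upTo (suc (length D′))))
      ≡ Maybe.map suc (Maybe.map suc (dropLength (splitAtDrop m D′)))
  firstAt-touch H′ D′ = begin
    firstAt (suc H′) EN (horizFrom (suc H′) EN 1) (map (λ i → i + 2) (upTo L))
      ≡⟨ cong₂ (firstAt (suc H′) EN) (trans (horizFrom-∷ {D = N ∷ D′} (wE w[]) 0) (horizFrom-0 H′ (N ∷ D′)))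
                                    (trans (map-cong (λ i → +-comm i 2) (upTo L)) (map-∘ (upTo L))) ⟩
    firstAt (suc H′) EN H′ (map suc (map suc (upTo L)))
      ≡⟨ firstAt-∷ {H = suc H′} {D = N ∷ D′} {h = H′} (wE w[]) (map suc (upTo L)) ⟩
    Maybe.map suc (firstAt H′ (N ∷ D′) H′ (map suc (upTo L)))
      ≡⟨ cong (Maybe.map suc) (firstAt-∷ {H = H′} {D = D′} {h = H′} (wN w[]) (upTo L)) ⟩
    Maybe.map suc (Maybe.map suc (firstAt (H′ + m) D′ H′ (upTo L)))
      ≡⟨ cong (Maybe.map suc ∘ Maybe.map suc) (firstAt-firstDrop m D′ (+-comm H′ m)) ⟩
    Maybe.map suc (Maybe.map suc (dropLength (splitAtDrop m D′))) ∎
    where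
    open ≡-Reasoning
    EN = E ∷ N ∷ D′
    L = suc (length D′)

  upAtFrom-head : ∀ H′ D′ → collect [ upAtFrom (suc H′) (E ∷ N ∷ D′) 1 ] ≡ rotateUp (splitAtDrop m D′)
  upAtFrom-head H′ D′ rewrite firstAt-touch H′ D′ with splitAtDrop m D′ in eq
  ... | nothing = refl
  ... | just (p , r) with splitAtDrop⁻ m D′ eq
  ... | _ , refl = cong [_] (cong₂ (λ u v → N ∷ u ++ E ∷ v) (take-length-++ p r) (drop-length-++ p r))

  upsFrom-∷ : ∀ {z y : Step} D′ → Walk H (z ∷ []) H′ → upsFrom H′ (y ∷ D′) ≡ upperCovers (y ∷ D′) →
              upsFrom H (z ∷ y ∷ D′) ≡ upperCovers (z ∷ y ∷ D′)
  upsFrom-∷ {H} {H′} {z} {y} D′ wz ih = begin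
    collect (f 1 ∷ map f (applyUpTo (λ i → suc (suc i)) L))
      ≡⟨ collect-∷ (f 1) _ ⟩
    collect [ f 1 ] ++ collect (map f (applyUpTo (λ i → suc (suc i)) L))
      ≡⟨ cong₂ _++_ (head z y wz) (cong collect rest) ⟩
    upMove (z ∷ y ∷ D′) ++ collect (map (Maybe.map (z ∷_)) (map g (applyUpTo suc L)))
      ≡⟨ cong (upMove (z ∷ y ∷ D′) ++_) (collect-map (z ∷_) (map g (applyUpTo suc L))) ⟩
    upMove (z ∷ y ∷ D′) ++ map (z ∷_) (upsFrom H′ (y ∷ D′))
      ≡⟨ cong (λ t → upMove (z ∷ y ∷ D′) ++ map (z ∷_) t) ih ⟩
    upperCovers (z ∷ y ∷ D′) ∎
    where
    open ≡-Reasoning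
    L = length D′
    f = upAtFrom H (z ∷ y ∷ D′)
    g = upAtFrom H′ (y ∷ D′)
    rest : map f (applyUpTo (λ i → suc (suc i)) L) ≡ map (Maybe.map (z ∷_)) (map g (applyUpTo suc L))
    rest = begin
      map f (applyUpTo (λ i → suc (suc i)) L)               ≡⟨ map-applyUpTo _ f L ⟩
      applyUpTo (λ k → f (suc (suc k))) L                   ≡⟨ map-upTo _ L ⟨
      map (λ k → f (suc (suc k))) (upTo L)                  ≡⟨ map-cong (upAtFrom-∷ {D = y ∷ D′} wz) (upTo L) ⟩
      map (λ k → Maybe.map (z ∷_) (g (suc k))) (upTo L)     ≡⟨ map-upTo _ L ⟩
      applyUpTo (λ k → Maybe.map (z ∷_) (g (suc k))) L      ≡⟨ map-applyUpTo suc _ L ⟨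
      map (Maybe.map (z ∷_) ∘ g) (applyUpTo suc L)          ≡⟨ map-∘ (applyUpTo suc L) ⟩
      map (Maybe.map (z ∷_)) (map g (applyUpTo suc L))      ∎
    head : ∀ z y → Walk H (z ∷ []) H′ → collect [ upAtFrom H (z ∷ y ∷ D′) 1 ] ≡ upMove (z ∷ y ∷ D′)
    head E N (wE w[]) = upAtFrom-head H′ D′
    head E E _ = refl
    head N N _ = refl
    head N E _ = refl

  upsFrom-upperCovers : Walk H D b → upsFrom H D ≡ upperCovers D
  upsFrom-upperCovers w[] = refl
  upsFrom-upperCovers (wN {x = []} w) = refl
  upsFrom-upperCovers (wE {x = []} w) = refl
  upsFrom-upperCovers (wN {x = _ ∷ D′} w) = upsFrom-∷ D′ (wN w[]) (upsFrom-upperCovers w)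
  upsFrom-upperCovers (wE {x = _ ∷ D′} w) = upsFrom-∷ D′ (wE w[]) (upsFrom-upperCovers w)

  -- Dyck paths and their degrees

  aboveFrom : ℕ → Path → Bool
  aboveFrom H D = all (λ k → countE (take k D) ≤ᵇ H + m * countN (take k D)) (upTo (suc (length D)))

  aboveFrom-∷ : ∀ H D → aboveFrom H (z ∷ D) ≡
                all (λ k → countE (take (suc k) (z ∷ D)) ≤ᵇ H + m * countN (take (suc k) (z ∷ D))) (upTo (suc (length D)))
  aboveFrom-∷ {z} H D = trans (cong (all q) (sym (map-upTo suc (suc (length D))))) (all-map q suc (upTo (suc (length D))))
    where q = λ k → countE (take k (z ∷ D)) ≤ᵇ H + m * countN (take k (z ∷ D))

  aboveFrom-N : ∀ H D → aboveFrom H (N ∷ D) ≡ aboveFrom (H + m) D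
  aboveFrom-N H D =
    trans (aboveFrom-∷ {N} H D) (all-cong (λ k → cong (countE (take k D) ≤ᵇ_) (shift (countN (take k D)))) (upTo (suc (length D))))
    where
    shift : ∀ c → H + m * suc c ≡ H + m + m * c
    shift c = trans (cong (H +_) (*-suc m c)) (sym (+-assoc H m (m * c)))

  aboveFrom-E : ∀ H D → aboveFrom (suc H) (E ∷ D) ≡ aboveFrom H D
  aboveFrom-E H D = trans (aboveFrom-∷ {E} (suc H) D) (all-cong (λ k → ≤ᵇ-suc (countE (take k D)) _) (upTo (suc (length D))))

  aboveFrom-E0 : ∀ D → aboveFrom 0 (E ∷ D) ≡ false
  aboveFrom-E0 D rewrite *-zeroʳ m = refl

  walk⇒aboveFrom : Walk H D b → aboveFrom H D ≡ true
  walk⇒aboveFrom w[] = refl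
  walk⇒aboveFrom {H} (wN {x = D} w) = trans (aboveFrom-N H D) (walk⇒aboveFrom w)
  walk⇒aboveFrom (wE {a = H} {x = D} w) = trans (aboveFrom-E H D) (walk⇒aboveFrom w)

  aboveFrom⇒walk : ∀ H D → aboveFrom H D ≡ true → ∃ λ b → Walk H D b
  aboveFrom⇒walk H [] _ = H , w[]
  aboveFrom⇒walk H (N ∷ D) above with aboveFrom⇒walk (H + m) D (trans (sym (aboveFrom-N H D)) above)
  ... | b , w = b , wN w
  aboveFrom⇒walk zero (E ∷ D) above with () ← trans (sym (aboveFrom-E0 D)) above
  aboveFrom⇒walk (suc H) (E ∷ D) above with aboveFrom⇒walk H D (trans (sym (aboveFrom-E H D)) above)
  ... | b , w = b , wE w

  module _ (n : ℕ) where

    ∈-dyckPaths⁻ : D ∈ dyckPaths m n → Walk 0 D 0 × countN D ≡ n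
    ∈-dyckPaths⁻ {D} D∈ with ∈-filter⁻ (T? ∘ aboveν m n) D∈
    ... | D∈words , above with ∈-words⁻ n (m * n) D∈words | aboveFrom⇒walk 0 D (Equivalence.to T-≡ above)
    ... | countN≡n , countE≡mn | b , w = subst (Walk 0 D) b≡0 w , countN≡n
      where
      b≡0 : b ≡ 0
      b≡0 = +-cancelʳ-≡ (m * n) b 0 (begin
        b + m * n        ≡⟨ cong (b +_) countE≡mn ⟨
        b + countE D     ≡⟨ walk-countN w ⟨
        m * countN D     ≡⟨ cong (m *_) countN≡n ⟩
        m * n            ∎)
        where open ≡-Reasoning

    ∈-dyckPaths⁺ : Walk 0 D 0 → countN D ≡ n → D ∈ dyckPaths m n
    ∈-dyckPaths⁺ {D} w countN≡n =
      ∈-filter⁺ (T? ∘ aboveν m n) (∈-words⁺ n (m * n) D countN≡n countE≡mn) (Equivalence.from T-≡ (walk⇒aboveFrom w))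
      where
      countE≡mn : countE D ≡ m * n
      countE≡mn = trans (sym (walk-countN w)) (cong (m *_) countN≡n)

    dyckPaths-unique : Unique (dyckPaths m n)
    dyckPaths-unique = Unique.filter⁺ (T? ∘ aboveν m n) (words-unique n (m * n))

    rotation-dyckPaths⁺ : D ∈ dyckPaths m n → Rotation D P → P ∈ dyckPaths m n
    rotation-dyckPaths⁺ D∈ rot with w , countN≡n ← ∈-dyckPaths⁻ D∈
      = ∈-dyckPaths⁺ (rotation-walk⁺ rot w) (trans (rotation-countN rot) countN≡n)

    rotation-dyckPaths⁻ : P ∈ dyckPaths m n → Rotation D P → D ∈ dyckPaths m n
    rotation-dyckPaths⁻ P∈ rot with w , countN≡n ← ∈-dyckPaths⁻ P∈
      = ∈-dyckPaths⁺ (rotation-walk⁻ rot w) (trans (sym (rotation-countN rot)) countN≡n)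

    coversᵇ⇔rotation : D ∈ dyckPaths m n → T (coversᵇ m n D P) ⇔ Rotation D P
    coversᵇ⇔rotation {D} {P} D∈ rewrite ups≡upsFrom n D | upsFrom-upperCovers (proj₁ (∈-dyckPaths⁻ D∈)) =
      mk⇔ (∈-upperCovers⁻ ∘ Equivalence.to (elemᵇ⇔∈ (upperCovers D)))
          (Equivalence.from (elemᵇ⇔∈ (upperCovers D)) ∘ ∈-upperCovers⁺)

    outDegree≡ : D ∈ dyckPaths m n → outDegree m n D ≡ length (upperCovers D)
    outDegree≡ {D} D∈ = count≡length (coversᵇ m n D) dyckPaths-unique (upperCovers-unique D)
      (λ _ → ⇔.trans (coversᵇ⇔rotation D∈) (mk⇔ ∈-upperCovers⁺ ∈-upperCovers⁻))
      (λ P∈ → rotation-dyckPaths⁺ D∈ (∈-upperCovers⁻ P∈))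

    inDegree≡ : D ∈ dyckPaths m n → inDegree m n D ≡ length (lowerCovers D)
    inDegree≡ {D} D∈ = count≡length (λ Q → coversᵇ m n Q D) dyckPaths-unique (lowerCovers-unique D)
      (λ Q∈ → ⇔.trans (coversᵇ⇔rotation {P = D} Q∈) (mk⇔ ∈-lowerCovers⁺ ∈-lowerCovers⁻))
      (λ Q∈ → rotation-dyckPaths⁻ D∈ (∈-lowerCovers⁻ Q∈))

  -- Trees

  data Tree : Set where
    leaf : Tree
    node : Vec Tree (suc m) → Tree

  mutual
    encode : Tree → Path
    encode leaf = []
    encode (node (t ∷ ts)) = N ∷ joined t ts

    joined : Tree → Vec Tree k → Path
    joined t [] = encode t
    joined t (u ∷ us) = encode t ++ E ∷ joined u us

  mutual
    encode-walk : ∀ t a → Walk a (encode t) a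
    encode-walk leaf a = w[]
    encode-walk (node (t ∷ ts)) a = wN (subst (λ c → Walk c (joined t ts) a) (+-comm m a) (joined-walk t ts a))

    joined-walk : ∀ t (ts : Vec Tree k) a → Walk (k + a) (joined t ts) a
    joined-walk t [] a = encode-walk t a
    joined-walk t (u ∷ us) a = walk-++ (encode-walk t _) (wE (joined-walk u us a))

  joined-firstDrop : ∀ t (ts : Vec Tree k) → ∃₂ λ pre T → FirstDrop k pre × joined t ts ≡ pre ++ encode T
  joined-firstDrop t [] = [] , t , fd[] , refl
  joined-firstDrop t (u ∷ us) with joined-firstDrop u us
  ... | pre , T , d , eq = encode t ++ E ∷ pre , T , walk-firstDrop-++ (encode-walk t 0) (fdE d) ,
                           trans (cong (λ x → encode t ++ E ∷ x) eq) (sym (++-assoc (encode t) (E ∷ pre) (encode T)))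

  splitAtDrop-joined : ∀ t (ts : Vec Tree m) y → ∃₂ λ pre T → splitAtDrop m (joined t ts ++ y) ≡ just (pre , encode T ++ y)
  splitAtDrop-joined t ts y with joined-firstDrop t ts
  ... | pre , T , d , eq rewrite eq | ++-assoc pre (encode T) y = pre , T , splitAtDrop-++ d (encode T ++ y)

  indeg outdeg isInternal : Tree → ℕ
  indeg t = length (lowerCovers (encode t))
  outdeg t = length (upperCovers (encode t))
  isInternal leaf = 0
  isInternal (node _) = 1

  total : (Tree → ℕ) → Vec Tree k → ℕ
  total f ts = Vec.sum (Vec.map f ts)

  internals : Vec Tree k → ℕ
  internals = total isInternal

  closingDrops-encode : ∀ t → closingDrops (encode t) ≡ isInternal t
  closingDrops-encode leaf = refl
  closingDrops-encode t@(node (_ ∷ _)) = closingDrops-walk (encode-walk t 0)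

  upMove-E-joined : ∀ u (us : Vec Tree k) → length (upMove (E ∷ joined u us)) ≡ isInternal u
  upMove-E-joined leaf [] = refl
  upMove-E-joined leaf (_ ∷ _) = refl
  upMove-E-joined (node (v ∷ vs)) [] with splitAtDrop-joined v vs []
  ... | _ , _ , eq rewrite ++-identityʳ (joined v vs) | eq = refl
  upMove-E-joined (node (v ∷ vs)) (w ∷ ws) with splitAtDrop-joined v vs (E ∷ joined w ws)
  ... | _ , _ , eq rewrite eq = refl

  lowerCovers-joined : ∀ t (ts : Vec Tree k) → length (lowerCovers (joined t ts)) ≡ total indeg (t ∷ ts) + internals (Vec.init (t ∷ ts))
  lowerCovers-joined t [] = sym (trans (+-identityʳ _) (+-identityʳ _))
  lowerCovers-joined t (u ∷ us) = begin
    length (lowerCovers (encode t ++ E ∷ joined u us))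
      ≡⟨ lowerCovers-++E (encode-walk t 0) (joined u us) ⟩
    indeg t + closingDrops (encode t) + length (lowerCovers (joined u us))
      ≡⟨ cong₂ (λ c l → indeg t + c + l) (closingDrops-encode t) (lowerCovers-joined u us) ⟩
    indeg t + isInternal t + (total indeg (u ∷ us) + internals (Vec.init (u ∷ us)))
      ≡⟨ interchange (indeg t) (isInternal t) _ _ ⟩
    total indeg (t ∷ u ∷ us) + internals (Vec.init (t ∷ u ∷ us)) ∎
    where open ≡-Reasoning

  upperCovers-joined : ∀ t (ts : Vec Tree k) → length (upperCovers (joined t ts)) ≡ total outdeg (t ∷ ts) + internals ts
  upperCovers-joined t [] = sym (trans (+-identityʳ _) (+-identityʳ _))
  upperCovers-joined t (u ∷ us) = begin
    length (upperCovers (encode t ++ E ∷ joined u us))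
      ≡⟨ upperCovers-++E (encode-walk t 0) (joined u us) ⟩
    outdeg t + length (upperCovers (E ∷ joined u us))
      ≡⟨ cong (outdeg t +_) (length-everywhere upMove E (joined u us)) ⟩
    outdeg t + (length (upMove (E ∷ joined u us)) + length (upperCovers (joined u us)))
      ≡⟨ cong₂ (λ i l → outdeg t + (i + l)) (upMove-E-joined u us) (upperCovers-joined u us) ⟩
    outdeg t + (isInternal u + (total outdeg (u ∷ us) + internals us))
      ≡⟨ cong (outdeg t +_) (x∙yz≈y∙xz (isInternal u) (total outdeg (u ∷ us)) (internals us)) ⟩
    outdeg t + (total outdeg (u ∷ us) + (isInternal u + internals us))
      ≡⟨ +-assoc (outdeg t) _ _ ⟨
    total outdeg (t ∷ u ∷ us) + internals (u ∷ us) ∎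
    where open ≡-Reasoning

  indeg-node : ∀ ts → indeg (node ts) ≡ total indeg ts + internals (Vec.init ts)
  indeg-node (t ∷ ts) with splitAtDrop-joined t ts []
  ... | _ , T , eq = begin
    length (lowerCovers (N ∷ joined t ts))
      ≡⟨ length-everywhere downMove N (joined t ts) ⟩
    length (rotateDown (splitAtDrop m (joined t ts))) + length (lowerCovers (joined t ts))
      ≡⟨ cong₂ _+_ (rootDown T (trans (cong (splitAtDrop m) (sym (++-identityʳ (joined t ts)))) eq)) (lowerCovers-joined t ts) ⟩
    total indeg (t ∷ ts) + internals (Vec.init (t ∷ ts)) ∎
    where
    open ≡-Reasoning
    rootDown : ∀ T {q pre} → q ≡ just (pre , encode T ++ []) → length (rotateDown q) ≡ 0
    rootDown leaf refl = refl
    rootDown (node (_ ∷ _)) refl = refl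

  outdeg-node : ∀ ts → outdeg (node ts) ≡ total outdeg ts + internals (Vec.tail ts)
  outdeg-node (t ∷ ts) = trans (length-everywhere upMove N (joined t ts)) (upperCovers-joined t ts)

  mutual
    decode-bounded : ∀ f D → length D < f → Walk 0 D 0 → ∃ λ t → encode t ≡ D
    decode-bounded (suc f) [] _ _ = leaf , refl
    decode-bounded (suc f) (N ∷ s) (s≤s s<f) (wN w) with decodeJoined-bounded f m s s<f w
    ... | t , ts , refl = node (t ∷ ts) , refl

    decodeJoined-bounded : ∀ f k s → length s < f → Walk k s 0 → ∃₂ λ t (ts : Vec Tree k) → joined t ts ≡ s
    decodeJoined-bounded f zero s s<f w with decode-bounded f s s<f w
    ... | t , refl = t , [] , refl
    decodeJoined-bounded f (suc k) s s<f w with walk-descent 0 w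
    ... | x , s′ , refl , wx , ws with length-++E x s′
    ... | x< , s′< with decode-bounded f x (<-trans x< s<f) wx | decodeJoined-bounded f k s′ (<-trans s′< s<f) ws
    ... | t , refl | u , us , refl = t , u ∷ us , refl

  decode : Walk 0 D 0 → ∃ λ t → encode t ≡ D
  decode {D} = decode-bounded (suc (length D)) D ≤-refl

  mutual
    encode-injective : ∀ t t′ → encode t ≡ encode t′ → t ≡ t′
    encode-injective leaf leaf _ = refl
    encode-injective leaf (node (_ ∷ _)) ()
    encode-injective (node (_ ∷ _)) leaf ()
    encode-injective (node (t ∷ ts)) (node (t′ ∷ ts′)) eq with joined-injective t t′ ts ts′ (∷-injectiveʳ eq)
    ... | refl , refl = refl

    joined-injective : ∀ t t′ (ts ts′ : Vec Tree k) → joined t ts ≡ joined t′ ts′ → t ≡ t′ × ts ≡ ts′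
    joined-injective t t′ [] [] eq = encode-injective t t′ eq , refl
    joined-injective t t′ (u ∷ us) (u′ ∷ us′) eq with walk-++E-injective (encode-walk t 0) (encode-walk t′ 0) eq
    ... | e , es with encode-injective t t′ e | joined-injective u u′ us us′ es
    ... | refl | refl , refl = refl , refl

  -- Mirroring

  mutual
    mirror : Tree → Tree
    mirror leaf = leaf
    mirror (node ts) = node (Vec.reverse (mirrors ts))

    mirrors : Vec Tree k → Vec Tree k
    mirrors [] = []
    mirrors (t ∷ ts) = mirror t ∷ mirrors ts

  mirrors≡map : ∀ (ts : Vec Tree k) → mirrors ts ≡ Vec.map mirror ts
  mirrors≡map [] = refl
  mirrors≡map (t ∷ ts) = cong (mirror t ∷_) (mirrors≡map ts)

  mirrors-reverse : ∀ (ts : Vec Tree k) → mirrors (Vec.reverse ts) ≡ Vec.reverse (mirrors ts)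
  mirrors-reverse ts = begin
    mirrors (Vec.reverse ts)           ≡⟨ mirrors≡map (Vec.reverse ts) ⟩
    Vec.map mirror (Vec.reverse ts)    ≡⟨ Vec.map-reverse mirror ts ⟩
    Vec.reverse (Vec.map mirror ts)    ≡⟨ cong Vec.reverse (mirrors≡map ts) ⟨
    Vec.reverse (mirrors ts)           ∎
    where open ≡-Reasoning

  mutual
    mirror-involutive : ∀ t → mirror (mirror t) ≡ t
    mirror-involutive leaf = refl
    mirror-involutive (node ts) = cong node (begin
      Vec.reverse (mirrors (Vec.reverse (mirrors ts)))  ≡⟨ cong Vec.reverse (mirrors-reverse (mirrors ts)) ⟩
      Vec.reverse (Vec.reverse (mirrors (mirrors ts)))  ≡⟨ Vec.reverse-involutive (mirrors (mirrors ts)) ⟩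
      mirrors (mirrors ts)                              ≡⟨ mirrors-involutive ts ⟩
      ts                                                ∎)
      where open ≡-Reasoning

    mirrors-involutive : ∀ (ts : Vec Tree k) → mirrors (mirrors ts) ≡ ts
    mirrors-involutive [] = refl
    mirrors-involutive (t ∷ ts) = cong₂ _∷_ (mirror-involutive t) (mirrors-involutive ts)

  mirror-injective : ∀ {t t′} → mirror t ≡ mirror t′ → t ≡ t′
  mirror-injective {t} {t′} eq = trans (sym (mirror-involutive t)) (trans (cong mirror eq) (mirror-involutive t′))

  total-reverse : ∀ f (ts : Vec Tree k) → total f (Vec.reverse ts) ≡ total f ts
  total-reverse f ts = trans (cong Vec.sum (Vec.map-reverse f ts)) (sum-reverse (Vec.map f ts))

  internals-mirrors : ∀ (ts : Vec Tree k) → internals (mirrors ts) ≡ internals ts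
  internals-mirrors [] = refl
  internals-mirrors (leaf ∷ ts) = internals-mirrors ts
  internals-mirrors (node _ ∷ ts) = cong suc (internals-mirrors ts)

  mutual
    indeg-mirror : ∀ t → indeg (mirror t) ≡ outdeg t
    indeg-mirror leaf = refl
    indeg-mirror (node (t ∷ ts)) = begin
      indeg (node (Vec.reverse ms))
        ≡⟨ indeg-node (Vec.reverse ms) ⟩
      total indeg (Vec.reverse ms) + internals (Vec.init (Vec.reverse ms))
        ≡⟨ cong₂ _+_ (total-reverse indeg ms) (trans (cong internals (Vec.init-reverse ms)) (total-reverse isInternal (mirrors ts))) ⟩
      total indeg ms + internals (mirrors ts)
        ≡⟨ cong₂ _+_ (total-indeg-mirrors (t ∷ ts)) (internals-mirrors ts) ⟩
      total outdeg (t ∷ ts) + internals ts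
        ≡⟨ outdeg-node (t ∷ ts) ⟨
      outdeg (node (t ∷ ts)) ∎
      where
      open ≡-Reasoning
      ms = mirrors (t ∷ ts)

    total-indeg-mirrors : ∀ (ts : Vec Tree k) → total indeg (mirrors ts) ≡ total outdeg ts
    total-indeg-mirrors [] = refl
    total-indeg-mirrors (t ∷ ts) = cong₂ _+_ (indeg-mirror t) (total-indeg-mirrors ts)

  size : Tree → ℕ
  size t = countN (encode t)

  countN-joined : ∀ t (ts : Vec Tree k) → countN (joined t ts) ≡ total size (t ∷ ts)
  countN-joined t [] = sym (+-identityʳ (size t))
  countN-joined t (u ∷ us) = trans (countN-++ (encode t) _) (cong (size t +_) (countN-joined u us))

  size-node : ∀ ts → size (node ts) ≡ suc (total size ts)
  size-node (t ∷ ts) = cong suc (countN-joined t ts)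

  mutual
    size-mirror : ∀ t → size (mirror t) ≡ size t
    size-mirror leaf = refl
    size-mirror (node ts) = begin
      size (node (Vec.reverse (mirrors ts)))       ≡⟨ size-node (Vec.reverse (mirrors ts)) ⟩
      suc (total size (Vec.reverse (mirrors ts)))  ≡⟨ cong suc (total-reverse size (mirrors ts)) ⟩
      suc (total size (mirrors ts))                ≡⟨ cong suc (total-size-mirrors ts) ⟩
      suc (total size ts)                          ≡⟨ size-node ts ⟨
      size (node ts)                               ∎
      where open ≡-Reasoning

    total-size-mirrors : ∀ (ts : Vec Tree k) → total size (mirrors ts) ≡ total size ts
    total-size-mirrors [] = refl
    total-size-mirrors (t ∷ ts) = cong₂ _+_ (size-mirror t) (total-size-mirrors ts)

  encodings : ∀ Ds → (∀ {D} → D ∈ Ds → Walk 0 D 0) → ∃ λ ts → map encode ts ≡ Ds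
  encodings [] _ = [] , refl
  encodings (D ∷ Ds) walks with decode (walks (here refl)) | encodings Ds (walks ∘ there)
  ... | t , refl | ts , refl = t ∷ ts , refl

  module _ (n : ℕ) where

    trees : List Tree
    trees = proj₁ (encodings (dyckPaths m n) (proj₁ ∘ ∈-dyckPaths⁻ n))

    map-encode-trees : map encode trees ≡ dyckPaths m n
    map-encode-trees = proj₂ (encodings (dyckPaths m n) (proj₁ ∘ ∈-dyckPaths⁻ n))

    encode-∈ : ∀ {t} → t ∈ trees → encode t ∈ dyckPaths m n
    encode-∈ t∈ = subst (_ ∈_) map-encode-trees (∈-map⁺ encode t∈)

    ∈-trees⇔size : ∀ {t} → t ∈ trees ⇔ size t ≡ n
    ∈-trees⇔size {t} = mk⇔ (proj₂ ∘ ∈-dyckPaths⁻ n ∘ encode-∈) from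
      where
      from : size t ≡ n → t ∈ trees
      from size≡n with ∈-map⁻ encode (subst (encode t ∈_) (sym map-encode-trees) (∈-dyckPaths⁺ n (encode-walk t 0) size≡n))
      ... | t′ , t′∈ , eq = subst (_∈ trees) (sym (encode-injective t t′ eq)) t′∈

    mirror-trees↭ : map mirror trees ↭ trees
    mirror-trees↭ = ∼bag⇒↭ (unique∧set⇒bag (Unique.map⁺ mirror-injective trees-unique) trees-unique (mk⇔ to from))
      where
      trees-unique : Unique trees
      trees-unique = Unique.map⁻ (subst Unique (sym map-encode-trees) (dyckPaths-unique n))
      sized : ∀ {t} → t ∈ trees → mirror t ∈ trees
      sized {t} t∈ = Equivalence.from ∈-trees⇔size (trans (size-mirror t) (Equivalence.to ∈-trees⇔size t∈))
      to : ∀ {t} → t ∈ map mirror trees → t ∈ trees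
      to t∈ with ∈-map⁻ mirror t∈
      ... | _ , t′∈ , refl = sized t′∈
      from : ∀ {t} → t ∈ trees → t ∈ map mirror trees
      from {t} t∈ = subst (_∈ map mirror trees) (mirror-involutive t) (∈-map⁺ mirror (sized t∈))

    inDegrees≡ : map (inDegree m n) (dyckPaths m n) ≡ map indeg trees
    inDegrees≡ = begin
      map (inDegree m n) (dyckPaths m n)       ≡⟨ cong (map (inDegree m n)) map-encode-trees ⟨
      map (inDegree m n) (map encode trees)    ≡⟨ map-∘ trees ⟨
      map (inDegree m n ∘ encode) trees        ≡⟨ map-cong-local (All.tabulate (inDegree≡ n ∘ encode-∈)) ⟩
      map indeg trees                          ∎
      where open ≡-Reasoning

    outDegrees≡ : map (outDegree m n) (dyckPaths m n) ≡ map indeg (map mirror trees)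
    outDegrees≡ = begin
      map (outDegree m n) (dyckPaths m n)      ≡⟨ cong (map (outDegree m n)) map-encode-trees ⟨
      map (outDegree m n) (map encode trees)   ≡⟨ map-∘ trees ⟨
      map (outDegree m n ∘ encode) trees
        ≡⟨ map-cong-local (All.tabulate (λ {t} t∈ → trans (outDegree≡ n (encode-∈ t∈)) (sym (indeg-mirror t)))) ⟩
      map (indeg ∘ mirror) trees               ≡⟨ map-∘ trees ⟩
      map indeg (map mirror trees)             ∎
      where open ≡-Reasoning

    degrees↭ : map (inDegree m n) (dyckPaths m n) ↭ map (outDegree m n) (dyckPaths m n)
    degrees↭ = subst₂ _↭_ (sym inDegrees≡) (sym outDegrees≡) (↭-sym (↭.map⁺ indeg mirror-trees↭))

mainTheorem11 : (m n : ℕ) → m ≥ 1 → n ≥ 1 → numMaxIn m n ≡ numMaxOut m n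
mainTheorem11 m n _ _ = begin
  numMaxIn m n                                      ≡⟨ count-maximal (inDegree m n) (dyckPaths m n) ⟩
  numMaximal (map (inDegree m n) (dyckPaths m n))   ≡⟨ numMaximal-↭ (Dyck.degrees↭ m n) ⟩
  numMaximal (map (outDegree m n) (dyckPaths m n))  ≡⟨ count-maximal (outDegree m n) (dyckPaths m n) ⟨
  numMaxOut m n                                     ∎
  where open ≡-Reasoning
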